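{- Let $n\geq 5$ and let $\overrightarrow{G}$ be a nontrivial weakly connected spanning closed subgraph of $\overrightarrow{C_n^2}$. If $E(\overrightarrow{G})$ contains no frame, then $n$ is odd and $\overrightarrow{G}=\overrightarrow{S_{n,\frac{n-1}{2},j}}$ for some integer $j$ with $0\leq j\leq n-1$.
   Context: For $n\geq 5$, the directed square cycle $\overrightarrow{C_n^2}$ has vertex set $\mathbb{Z}_n$, writing $v_i=i+n\mathbb{Z}$ for $i\in\mathbb{Z}$ (indices modulo $n$), and edges $e_i=(v_i,v_{i+1})$ (frames) and $f_i=(v_i,v_{i+2})$ (windows), $i\in\mathbb{Z}$. A spanning subgraph has vertex set $\mathbb{Z}_n$ and a subset of the edges; it is weakly connected if its underlying undirected graph is connected. The triangle $T_i$ is $\{e_i,e_{i+1},f_i\}$; a subgraph $\overrightarrow{G}$ is closed if for every $i$, $|T_i\cap E(\overrightarrow{G})|\leq 1$ or $T_i\subseteq E(\overrightarrow{G})$. The trivial weakly connected spanning closed subgraphs are $\overrightarrow{C_n^2}$ itself and, when $n$ is odd, the subgraph whose edges are all the windows $f_0,\dots,f_{n-1}$; all others are nontrivial. For integers $j,k$ with $0\leq k\leq\lceil\frac{n-2}{2}\rceil$, $\overrightarrow{S_{n,k,j}}$ is the spanning subgraph of $\overrightarrow{C_n^2}$ with edge set $E(\overrightarrow{C_n^2})\setminus\big(\{f_{j-2},f_{j+2k-1}\}\cup\{e_{j-1},e_j,\dots,e_{j+2k-1}\}\big)$. -}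

module Defs where

open import Data.Nat as ℕ using (ℕ; zero; suc; NonZero; _≤_; _∸_)
open import Data.Nat.DivMod using (_%_; _/_)
open import Data.Integer as ℤ using (ℤ; +_)
open import Data.Integer.DivMod using (_%ℕ_; n%ℕd<d)
open import Data.Fin using (Fin; toℕ; fromℕ<)
open import Data.Bool using (Bool; true; false)
open import Data.Product using (Σ; ∃; _×_; _,_)
open import Data.Sum using (_⊎_)
open import Relation.Nullary using (¬_)
open import Relation.Binary.PropositionalEquality using (_≡_)
open import Relation.Binary.Construct.Closure.ReflexiveTransitive using (Star)
open import Function.Bundles using (_⇔_)

v : (n : ℕ) .{{_ : NonZero n}} → ℤ → Fin n
v n i = fromℕ< (n%ℕd<d i n)

ι : {n : ℕ} → Fin n → ℤ
ι a = + toℕ a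

-- A spanning subgraph of the directed square cycle on ℤ_n:
-- frame i = true  iff  e_i = (v_i, v_{i+1}) is an edge,
-- window i = true iff  f_i = (v_i, v_{i+2}) is an edge.
record Subgraph (n : ℕ) : Set where
  field
    frame  : Fin n → Bool
    window : Fin n → Bool
open Subgraph public

eIn fIn : {n : ℕ} .{{_ : NonZero n}} → Subgraph n → ℤ → Bool
eIn {n} G i = frame G (v n i)
fIn {n} G i = window G (v n i)

b2n : Bool → ℕ
b2n true  = 1
b2n false = 0

Closed : {n : ℕ} .{{_ : NonZero n}} → Subgraph n → Set
Closed G = ∀ (i : ℤ) →
  (b2n (eIn G i) ℕ.+ b2n (eIn G (i ℤ.+ + 1)) ℕ.+ b2n (fIn G i) ≤ 1)
  ⊎ (eIn G i ≡ true × eIn G (i ℤ.+ + 1) ≡ true × fIn G i ≡ true)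

Arc : {n : ℕ} .{{_ : NonZero n}} → Subgraph n → Fin n → Fin n → Set
Arc {n} G a b =
  (∃ λ (i : ℤ) → eIn G i ≡ true × v n i ≡ a × v n (i ℤ.+ + 1) ≡ b)
  ⊎ (∃ λ (i : ℤ) → fIn G i ≡ true × v n i ≡ a × v n (i ℤ.+ + 2) ≡ b)

UAdj : {n : ℕ} .{{_ : NonZero n}} → Subgraph n → Fin n → Fin n → Set
UAdj G a b = Arc G a b ⊎ Arc G b a

WeaklyConnected : {n : ℕ} .{{_ : NonZero n}} → Subgraph n → Set
WeaklyConnected G = ∀ a b → Star (UAdj G) a b

_≐_ : {n : ℕ} → Subgraph n → Subgraph n → Set
G ≐ H = (∀ i → frame G i ≡ frame H i) × (∀ i → window G i ≡ window H i)

Odd : ℕ → Set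
Odd n = n % 2 ≡ 1

Full : (n : ℕ) → Subgraph n
Full n = record { frame = λ _ → true ; window = λ _ → true }

AllWindows : (n : ℕ) → Subgraph n
AllWindows n = record { frame = λ _ → false ; window = λ _ → true }

Trivial : {n : ℕ} → Subgraph n → Set
Trivial {n} G = (G ≐ Full n) ⊎ (Odd n × (G ≐ AllWindows n))

Nontrivial : {n : ℕ} → Subgraph n → Set
Nontrivial G = ¬ Trivial G

-- S_{n,k,j}: E(C_n^2) minus {f_{j-2}, f_{j+2k-1}} ∪ {e_{j-1}, ..., e_{j+2k-1}}
-- (frame membership stated as a proposition; G ≐S S means edge sets coincide)
RemovedFrame : (n : ℕ) .{{_ : NonZero n}} → ℕ → ℤ → Fin n → Set
RemovedFrame n k j a = ∃ λ (t : ℕ) → t ≤ 2 ℕ.* k × v n (j ℤ.- + 1 ℤ.+ + t) ≡ a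

RemovedWindow : (n : ℕ) .{{_ : NonZero n}} → ℕ → ℤ → Fin n → Set
RemovedWindow n k j a = v n (j ℤ.- + 2) ≡ a ⊎ v n (j ℤ.+ + (2 ℕ.* k) ℤ.- + 1) ≡ a

IsS : (n : ℕ) .{{_ : NonZero n}} → ℕ → ℤ → Subgraph n → Set
IsS n k j G =
  (∀ a → (frame G a ≡ true) ⇔ (¬ RemovedFrame n k j a))
  × (∀ a → (window G a ≡ true) ⇔ (¬ RemovedWindow n k j a))

module Submission where

{-
Without frames every edge of G is a window f_i = (v_i, v_{i+2}), so any property of
vertices that is preserved in both directions along the windows of G is preserved along
every undirected path. For even n, "v_{2t} for some t" is such a property which v_1 lacks,
so G is disconnected. For odd n, 2 is invertible modulo n, so from any s the windows visit
v_s, v_{s+2}, ..., v_{s+2(n-1)} = v_{s-2}, i.e. all vertices. Nontriviality makes some window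
f_m missing. If a second window f_{m'} were missing, the arc of this cycle from v_{m+2} to
v_{m'} would be preserved by the remaining windows but would not contain v_m. So f_m is the
only missing window, and G is S_{n,k,m+2} with 2k + 1 = n: the 2k + 1 removed frames are all
of them, and both removed windows f_{j-2}, f_{j+2k-1} are f_m.
-}

open import Defs
open import Data.Nat as ℕ using (ℕ; zero; suc; NonZero; _≤_; _<_)
import Data.Nat.Properties as ℕ
open import Data.Nat.DivMod using (m<n⇒m%n≡m; m%n<n; m≡m%n+[m/n]*n; m*n/n≡m)
open import Data.Nat.Divisibility using (>⇒∤; ∣1⇒≡1; m%n≡0⇒n∣m) renaming (_∣_ to _∣ℕ_)
open import Data.Integer using (ℤ; +_; 0ℤ; _+_; _*_; _-_; -_; ∣_∣)
open import Data.Integer.Properties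
  using (+-identityʳ; pos-*; m-n≡m⊖n; ∣m⊝n∣≤m⊔n; ∣i∣≡0⇒i≡0; i-j≡0⇒i≡j; +-injective)
open import Data.Integer.Divisibility.Signed
  using (_∣_; divides; ∣⇒∣ᵤ; ∣ᵤ⇒∣; ∣-trans; ∣m∣n⇒∣m+n; ∣m⇒∣-m; ∣n⇒∣m*n)
open import Data.Integer.DivMod using (_%ℕ_; _/ℕ_; n%ℕd<d; a≡a%ℕn+[a/ℕn]*n)
open import Data.Integer.Tactic.RingSolver using (solve)
open import Data.Fin using (Fin; toℕ)
open import Data.Fin.Properties using (toℕ-fromℕ<; toℕ-injective; toℕ<n; ¬∀⟶∃¬)
open import Data.List using (_∷_; [])
open import Data.Product using (∃; _×_; _,_)
open import Function using (_∘_; id)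
open import Function.Bundles using (_⇔_; mk⇔; Equivalence)
open import Data.Empty using (⊥-elim)
open import Relation.Nullary using (¬_; contradiction; yes; no)
open import Data.Sum using (_⊎_; inj₁; inj₂)
import Data.Bool as Bool
open import Data.Bool using (true; false)
open import Data.Bool.Properties using (not-¬; ¬-not)
open import Relation.Binary.Construct.Closure.ReflexiveTransitive using (Star; ε; _◅_)
open import Relation.Binary.Bundles using (Setoid)
import Relation.Binary.Reasoning.Setoid as SetoidReasoning
open import Relation.Binary.PropositionalEquality

-- A record rather than a definition so that i and j can be inferred from a proof.
infix 4 _≡_mod_
record _≡_mod_ (i j m : ℤ) : Set where
  constructor ∣⇒≡-mod
  field ≡-mod⇒∣ : m ∣ i - j
open _≡_mod_

module _ {m : ℤ} where

  ∣-via : ∀ {x i j} → m ∣ x → x ≡ i - j → i ≡ j mod m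
  ∣-via m∣x refl = ∣⇒≡-mod m∣x

  mod-reflexive : ∀ {i j} → i ≡ j → i ≡ j mod m
  mod-reflexive {i} refl = ∣-via (divides 0ℤ refl) (solve (i ∷ m ∷ []))

  mod-sym : ∀ {i j} → i ≡ j mod m → j ≡ i mod m
  mod-sym {i} {j} (∣⇒≡-mod p) = ∣-via (∣m⇒∣-m p) (solve (i ∷ j ∷ []))

  mod-trans : ∀ {i j k} → i ≡ j mod m → j ≡ k mod m → i ≡ k mod m
  mod-trans {i} {j} {k} (∣⇒≡-mod p) (∣⇒≡-mod q) = ∣-via (∣m∣n⇒∣m+n p q) (solve (i ∷ j ∷ k ∷ []))

  mod-setoid : Setoid _ _
  mod-setoid = record
    { Carrier = ℤ
    ; _≈_ = _≡_mod m
    ; isEquivalence = record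
      { refl = mod-reflexive refl ; sym = mod-sym ; trans = mod-trans }
    }

  +-congʳ-mod : ∀ {i j} c → i ≡ j mod m → i + c ≡ j + c mod m
  +-congʳ-mod {i} {j} c (∣⇒≡-mod p) = ∣-via p (solve (i ∷ j ∷ c ∷ []))

  +-congˡ-mod : ∀ {i j} c → i ≡ j mod m → c + i ≡ c + j mod m
  +-congˡ-mod {i} {j} c (∣⇒≡-mod p) = ∣-via p (solve (i ∷ j ∷ c ∷ []))

  *-congˡ-mod : ∀ {i j} c → i ≡ j mod m → c * i ≡ c * j mod m
  *-congˡ-mod {i} {j} c (∣⇒≡-mod p) = ∣-via (∣n⇒∣m*n c p) (solve (i ∷ j ∷ c ∷ []))

  *-congʳ-mod : ∀ {i j} c → i ≡ j mod m → i * c ≡ j * c mod m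
  *-congʳ-mod {i} {j} c (∣⇒≡-mod p) = ∣-via (∣n⇒∣m*n c p) (solve (i ∷ j ∷ c ∷ []))

  +-cancelˡ-mod : ∀ {i j} c → c + i ≡ c + j mod m → i ≡ j mod m
  +-cancelˡ-mod {i} {j} c (∣⇒≡-mod p) = ∣-via p (solve (i ∷ j ∷ c ∷ []))

  +-cancelʳ-mod : ∀ {i j} c → i + c ≡ j + c mod m → i ≡ j mod m
  +-cancelʳ-mod {i} {j} c (∣⇒≡-mod p) = ∣-via p (solve (i ∷ j ∷ c ∷ []))

  +-multiple-mod : ∀ i q → i + q * m ≡ i mod m
  +-multiple-mod i q = ∣-via (divides q refl) (solve (i ∷ q ∷ m ∷ []))

  mod-∣ : ∀ {d i j} → d ∣ m → i ≡ j mod m → i ≡ j mod d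
  mod-∣ d∣m (∣⇒≡-mod m∣i-j) = ∣⇒≡-mod (∣-trans d∣m m∣i-j)

  *-cancelˡ-mod : ∀ {a c x y} → a * c ≡ + 1 mod m → a * x ≡ a * y mod m → x ≡ y mod m
  *-cancelˡ-mod {a} {c} {x} {y} ac≡1 ax≡ay = begin
    x              ≡⟨ solve (x ∷ []) ⟩
    + 1 * x        ≈⟨ *-congʳ-mod x ac≡1 ⟨
    (a * c) * x    ≡⟨ solve (a ∷ c ∷ x ∷ []) ⟩
    c * (a * x)    ≈⟨ *-congˡ-mod c ax≡ay ⟩
    c * (a * y)    ≡⟨ solve (a ∷ c ∷ y ∷ []) ⟩
    (a * c) * y    ≈⟨ *-congʳ-mod y ac≡1 ⟩
    + 1 * y        ≡⟨ solve (y ∷ []) ⟩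
    y              ∎
    where open SetoidReasoning mod-setoid

module _ {n : ℕ} where

  <∧∣⇒≡0 : ∀ {m} → m < n → n ∣ℕ m → m ≡ 0
  <∧∣⇒≡0 {zero}  _   _   = refl
  <∧∣⇒≡0 {suc m} m<n n∣m = contradiction n∣m (>⇒∤ m<n)

  mod-<⇒≡ : ∀ {a b} → a < n → b < n → + a ≡ + b mod + n → a ≡ b
  mod-<⇒≡ {a} {b} a<n b<n a≡b =
    +-injective (i-j≡0⇒i≡j (+ a) (+ b) (∣i∣≡0⇒i≡0 (<∧∣⇒≡0 ∣a-b∣<n (∣⇒∣ᵤ (≡-mod⇒∣ a≡b)))))
    where
    ∣a-b∣<n : ∣ + a - + b ∣ < n
    ∣a-b∣<n = subst (_< n) (cong ∣_∣ (sym (m-n≡m⊖n a b)))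
                (ℕ.≤-<-trans (∣m⊝n∣≤m⊔n a b) (ℕ.⊔-lub a<n b<n))

1≢0-mod-2 : ¬ (+ 1 ≡ 0ℤ mod + 2)
1≢0-mod-2 (∣⇒≡-mod 2∣1) with ∣1⇒≡1 (∣⇒∣ᵤ 2∣1)
... | ()

module _ (n : ℕ) .{{_ : NonZero n}} where

  module ≡-mod-Reasoning = SetoidReasoning (mod-setoid {+ n})

  ≡-%ℕ-mod : ∀ i → i ≡ + (i %ℕ n) mod + n
  ≡-%ℕ-mod i = mod-trans (mod-reflexive (a≡a%ℕn+[a/ℕn]*n i n)) (+-multiple-mod _ (i /ℕ n))

  offset-mod : ∀ i j → ∃ λ t → t < n × i + + t ≡ j mod + n
  offset-mod i j = (j - i) %ℕ n , n%ℕd<d (j - i) n , (begin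
    i + + ((j - i) %ℕ n)  ≈⟨ +-congˡ-mod i (≡-%ℕ-mod (j - i)) ⟨
    i + (j - i)           ≡⟨ solve (i ∷ j ∷ []) ⟩
    j                     ∎)
    where open ≡-mod-Reasoning

  toℕ-v : ∀ i → toℕ (v n i) ≡ i %ℕ n
  toℕ-v i = toℕ-fromℕ< (n%ℕd<d i n)

  v-injective-mod : ∀ {i j} → v n i ≡ v n j → i ≡ j mod + n
  v-injective-mod {i} {j} vi≡vj = begin
    i             ≈⟨ ≡-%ℕ-mod i ⟩
    + (i %ℕ n)    ≡⟨ cong +_ (trans (sym (toℕ-v i)) (trans (cong toℕ vi≡vj) (toℕ-v j))) ⟩
    + (j %ℕ n)    ≈⟨ ≡-%ℕ-mod j ⟨
    j             ∎
    where open ≡-mod-Reasoning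

  v-cong-mod : ∀ {i j} → i ≡ j mod + n → v n i ≡ v n j
  v-cong-mod {i} {j} i≡j = toℕ-injective (trans (toℕ-v i) (trans i%n≡j%n (sym (toℕ-v j))))
    where
    i%n≡j%n : i %ℕ n ≡ j %ℕ n
    i%n≡j%n = mod-<⇒≡ (n%ℕd<d i n) (n%ℕd<d j n)
      (mod-trans (mod-sym (≡-%ℕ-mod i)) (mod-trans i≡j (≡-%ℕ-mod j)))

  v-ι : ∀ a → v n (ι a) ≡ a
  v-ι a = toℕ-injective (trans (toℕ-v (ι a)) (m<n⇒m%n≡m (toℕ<n a)))

  ι-v : ∀ i → ι (v n i) ≡ i mod + n
  ι-v i = mod-sym (mod-trans (≡-%ℕ-mod i) (mod-reflexive (cong +_ (sym (toℕ-v i)))))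

  v-+-congʳ : ∀ {i j} c → v n i ≡ v n j → v n (i + c) ≡ v n (j + c)
  v-+-congʳ {i} {j} c vi≡vj = v-cong-mod (+-congʳ-mod c (v-injective-mod {i} {j} vi≡vj))

  v-+-cancelʳ : ∀ {i j} c → v n (i + c) ≡ v n (j + c) → v n i ≡ v n j
  v-+-cancelʳ {i} {j} c vi+c≡vj+c =
    v-cong-mod {i} {j} (+-cancelʳ-mod c (v-injective-mod {i + c} {j + c} vi+c≡vj+c))

  v-offset : ∀ i a → ∃ λ t → t < n × v n (i + + t) ≡ a
  v-offset i a =
    let t , t<n , i+t≡a = offset-mod i (ι a)
    in t , t<n , trans (v-cong-mod i+t≡a) (v-ι a)

  2*-offset-mod : ∀ {c} → + 2 * c ≡ + 1 mod + n →
    ∀ s y → ∃ λ u → u < n × s + + 2 * + u ≡ y mod + n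
  2*-offset-mod {c} 2c≡1 s y = x %ℕ n , n%ℕd<d x n , (begin
    s + + 2 * + (x %ℕ n)      ≈⟨ +-congˡ-mod s (*-congˡ-mod (+ 2) (≡-%ℕ-mod x)) ⟨
    s + + 2 * ((y - s) * c)   ≡⟨ solve (s ∷ y ∷ c ∷ []) ⟩
    s + (+ 2 * c) * (y - s)   ≈⟨ +-congˡ-mod s (*-congʳ-mod (y - s) 2c≡1) ⟩
    s + + 1 * (y - s)         ≡⟨ solve (s ∷ y ∷ []) ⟩
    y                         ∎)
    where
    open ≡-mod-Reasoning
    x : ℤ
    x = (y - s) * c

  walk : ℤ → ℕ → Fin n
  walk s u = v n (s + + 2 * + u)

  walk-zero : ∀ s → walk s 0 ≡ v n s
  walk-zero s = cong (v n) (+-identityʳ s)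

  walk-suc : ∀ {s i} u → walk s u ≡ v n i ⇔ walk s (suc u) ≡ v n (i + + 2)
  walk-suc {s} {i} u = mk⇔
    (λ e → trans (cong (v n) (step (+ u))) (v-+-congʳ {s + + 2 * + u} {i} (+ 2) e))
    (λ e → v-+-cancelʳ {s + + 2 * + u} {i} (+ 2) (trans (sym (cong (v n) (step (+ u)))) e))
    where
    step : ∀ x → s + + 2 * (+ 1 + x) ≡ s + + 2 * x + + 2
    step x = solve (s ∷ x ∷ [])

  walk-last : ∀ {t} → n ≡ suc t → ∀ a → walk (ι a + + 2) t ≡ a
  walk-last {t} n≡1+t a = trans (v-cong-mod (begin
    ι a + + 2 + + 2 * + t       ≡⟨ around (ι a) (+ t) ⟩
    ι a + + 2 * (+ 1 + + t)     ≡⟨ cong (λ l → ι a + + 2 * + l) n≡1+t ⟨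
    ι a + + 2 * + n             ≈⟨ +-multiple-mod (ι a) (+ 2) ⟩
    ι a                         ∎)) (v-ι a)
    where
    open ≡-mod-Reasoning
    around : ∀ x y → x + + 2 + + 2 * y ≡ x + + 2 * (+ 1 + y)
    around x y = solve (x ∷ y ∷ [])

  walk-surjective : ∀ {c} → + 2 * c ≡ + 1 mod + n → ∀ s a → ∃ λ u → u < n × walk s u ≡ a
  walk-surjective 2c≡1 s a =
    let u , u<n , s+2u≡a = 2*-offset-mod 2c≡1 s (ι a)
    in u , u<n , trans (v-cong-mod s+2u≡a) (v-ι a)

  walk-injective : ∀ {c s u u'} → + 2 * c ≡ + 1 mod + n → u < n → u' < n →
    walk s u ≡ walk s u' → u ≡ u'
  walk-injective {c} {s} {u} {u'} 2c≡1 u<n u'<n walk-u≡walk-u' =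
    mod-<⇒≡ u<n u'<n
      (*-cancelˡ-mod {a = + 2} {c} 2c≡1 (+-cancelˡ-mod s (v-injective-mod walk-u≡walk-u')))

  Frameless : Subgraph n → Set
  Frameless G = ∀ a → frame G a ≡ false

  WindowInvariant : Subgraph n → (Fin n → Set) → Set
  WindowInvariant G P = ∀ i → fIn G i ≡ true → P (v n i) ⇔ P (v n (i + + 2))

  frameless-reach-invariant : ∀ {G P a b} → Frameless G → WindowInvariant G P →
    Star (UAdj G) a b → P a → P b
  frameless-reach-invariant {G} {P} frameless invariant = reach
    where
    arc-invariant : ∀ {a b} → Arc G a b → P a ⇔ P b
    arc-invariant (inj₁ (i , present , _))           = contradiction present (not-¬ (frameless (v n i)))
    arc-invariant (inj₂ (i , present , refl , refl)) = invariant i present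

    reach : ∀ {a b} → Star (UAdj G) a b → P a → P b
    reach ε                 = id
    reach (inj₁ arc ◅ path) = reach path ∘ Equivalence.to (arc-invariant arc)
    reach (inj₂ arc ◅ path) = reach path ∘ Equivalence.from (arc-invariant arc)

  even-frameless-disconnected : ∀ {G} → 2 ∣ℕ n → Frameless G → ¬ WeaklyConnected G
  even-frameless-disconnected {G} 2∣n frameless connected =
    1-not-even (frameless-reach-invariant {G} {Even} frameless even-invariant
                 (connected (v n 0ℤ) (v n (+ 1))) (0ℤ , refl))
    where
    Even : Fin n → Set
    Even a = ∃ λ t → v n (+ 2 * t) ≡ a

    even-invariant : WindowInvariant G Even
    even-invariant i _ = mk⇔ forward backward
      where
      forward : Even (v n i) → Even (v n (i + + 2))
      forward (t , v2t≡vi) =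
        t + + 1 , trans (cong (v n) (2[t+1]≡2t+2 t)) (v-+-congʳ {+ 2 * t} {i} (+ 2) v2t≡vi)
        where
        2[t+1]≡2t+2 : ∀ t → + 2 * (t + + 1) ≡ + 2 * t + + 2
        2[t+1]≡2t+2 t = solve (t ∷ [])

      backward : Even (v n (i + + 2)) → Even (v n i)
      backward (t , v2t≡vi+2) =
        t - + 1 , v-+-cancelʳ {+ 2 * (t - + 1)} {i} (+ 2) (trans (cong (v n) (2[t-1]+2≡2t t)) v2t≡vi+2)
        where
        2[t-1]+2≡2t : ∀ t → + 2 * (t - + 1) + + 2 ≡ + 2 * t
        2[t-1]+2≡2t t = solve (t ∷ [])

    1-not-even : ¬ Even (v n (+ 1))
    1-not-even (t , v2t≡v1) = 1≢0-mod-2 (mod-trans (mod-sym 2t≡1) 2t≡0)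
      where
      2t≡1 : + 2 * t ≡ + 1 mod + 2
      2t≡1 = mod-∣ (∣ᵤ⇒∣ 2∣n) (v-injective-mod v2t≡v1)
      2t≡0 : + 2 * t ≡ 0ℤ mod + 2
      2t≡0 = ∣-via (divides t refl) (solve (t ∷ []))

  missing≢present : ∀ {G : Subgraph n} a b → window G a ≡ false → window G b ≡ true → a ≢ b
  missing≢present _ _ missing present refl = not-¬ present missing

  2*[1+k]≡1-mod : ∀ {k} → n ≡ suc (2 ℕ.* k) → + 2 * + suc k ≡ + 1 mod + n
  2*[1+k]≡1-mod {k} n≡1+2k = begin
    + 2 * (+ 1 + + k)             ≡⟨ regroup (+ k) ⟩
    + 1 + + 1 * (+ 1 + + 2 * + k) ≡⟨ cong (λ x → + 1 + + 1 * x) n≡1+2k-ℤ ⟨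
    + 1 + + 1 * + n               ≈⟨ +-multiple-mod (+ 1) (+ 1) ⟩
    + 1                           ∎
    where
    open ≡-mod-Reasoning
    n≡1+2k-ℤ : + n ≡ + 1 + + 2 * + k
    n≡1+2k-ℤ = trans (cong +_ n≡1+2k) (cong (λ x → + 1 + x) (pos-* 2 k))
    regroup : ∀ x → + 2 * (+ 1 + x) ≡ + 1 + + 1 * (+ 1 + + 2 * x)
    regroup x = solve (x ∷ [])

  WalkSegment : ℤ → ℕ → Fin n → Set
  WalkSegment s t a = ∃ λ u → u ≤ t × walk s u ≡ a

  walk-segment-invariant : ∀ {G m t} → window G m ≡ false → window G (walk (ι m + + 2) t) ≡ false →
    WindowInvariant G (WalkSegment (ι m + + 2) t)
  walk-segment-invariant {G} {m} {t} m-missing end-missing i present = mk⇔ forward backward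
    where
    s : ℤ
    s = ι m + + 2

    forward : WalkSegment s t (v n i) → WalkSegment s t (v n (i + + 2))
    forward (u , u≤t , walk-u≡i) with u ℕ.≟ t
    ... | yes refl = contradiction walk-u≡i (missing≢present {G} (walk s t) (v n i) end-missing present)
    ... | no u≢t   = suc u , ℕ.≤∧≢⇒< u≤t u≢t , Equivalence.to (walk-suc {s} {i} u) walk-u≡i

    backward : WalkSegment s t (v n (i + + 2)) → WalkSegment s t (v n i)
    backward (zero , _ , walk-0≡i+2) =
      contradiction m≡i (missing≢present {G} m (v n i) m-missing present)
      where
      m≡i : m ≡ v n i
      m≡i = trans (sym (v-ι m)) (v-+-cancelʳ {ι m} {i} (+ 2) (trans (sym (walk-zero s)) walk-0≡i+2))
    backward (suc u , u<t , walk-1+u≡i+2) =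
      u , ℕ.<⇒≤ u<t , Equivalence.from (walk-suc {s} {i} u) walk-1+u≡i+2

  walk-between-missing-is-full : ∀ {k G m t} → n ≡ suc (2 ℕ.* k) → Frameless G → WeaklyConnected G →
    window G m ≡ false → window G (walk (ι m + + 2) t) ≡ false → t < n → t ≡ 2 ℕ.* k
  walk-between-missing-is-full {k} {G} {m} {t} n≡1+2k frameless connected m-missing end-missing t<n =
    let u , u≤t , walk-u≡m = frameless-reach-invariant {G} {WalkSegment s t} frameless
                               (walk-segment-invariant {G} {m} {t} m-missing end-missing)
                               (connected (v n s) m) (0 , ℕ.z≤n , walk-zero s)
        u≡2k = walk-injective {+ suc k} {s} (2*[1+k]≡1-mod {k} n≡1+2k) (ℕ.≤-<-trans u≤t t<n) 2k<n
                 (trans walk-u≡m (sym (walk-last n≡1+2k m)))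
    in ℕ.≤-antisym (ℕ.≤-pred (subst (t <_) n≡1+2k t<n)) (subst (_≤ t) u≡2k u≤t)
    where
    s : ℤ
    s = ι m + + 2

    2k<n : 2 ℕ.* k < n
    2k<n = subst (2 ℕ.* k <_) (sym n≡1+2k) (ℕ.n<1+n _)

  missing-window-unique : ∀ {k G m m'} → n ≡ suc (2 ℕ.* k) → Frameless G → WeaklyConnected G →
    window G m ≡ false → window G m' ≡ false → m ≡ m'
  missing-window-unique {k} {G} {m} {m'} n≡1+2k frameless connected m-missing m'-missing =
    let t , t<n , walk-t≡m' = walk-surjective {+ suc k} (2*[1+k]≡1-mod {k} n≡1+2k) s m'
        t≡2k = walk-between-missing-is-full {k} {G} {m} {t} n≡1+2k frameless connected m-missing
                 (subst (λ a → window G a ≡ false) (sym walk-t≡m') m'-missing) t<n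
    in begin
      m                 ≡⟨ walk-last n≡1+2k m ⟨
      walk s (2 ℕ.* k)  ≡⟨ cong (walk s) t≡2k ⟨
      walk s t          ≡⟨ walk-t≡m' ⟩
      m'                ∎
    where
    open ≡-Reasoning
    s : ℤ
    s = ι m + + 2

  nontrivial⇒missing-window : ∀ {G} → Odd n → Nontrivial G → Frameless G →
    ∃ λ m → window G m ≡ false
  nontrivial⇒missing-window {G} odd nontrivial frameless =
    let m , ¬present = ¬∀⟶∃¬ n (λ a → window G a ≡ true) (λ a → window G a Bool.≟ true)
                         (λ all-present → nontrivial (inj₂ (odd , frameless , all-present)))
    in m , ¬-not ¬present

  frameless-connected-IsS : ∀ {k G m} → n ≡ suc (2 ℕ.* k) → Frameless G → WeaklyConnected G →
    window G m ≡ false → IsS n k (ι (v n (ι m + + 2))) G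
  frameless-connected-IsS {k} {G} {m} n≡1+2k frameless connected m-missing =
    (λ a → mk⇔ (λ present → contradiction present (not-¬ (frameless a)))
                (λ ¬removed → ⊥-elim (¬removed (frame-removed a))))
    , (λ a → mk⇔ (present-not-removed a) (not-removed-present a))
    where
    j : ℤ
    j = ι (v n (ι m + + 2))

    frame-removed : ∀ a → RemovedFrame n k j a
    frame-removed a =
      let t , t<n , e = v-offset (j - + 1) a
      in t , ℕ.≤-pred (subst (t <_) n≡1+2k t<n) , e

    j-2≡m : v n (j - + 2) ≡ m
    j-2≡m = trans (v-cong-mod (begin
      j - + 2              ≈⟨ +-congʳ-mod (- + 2) (ι-v (ι m + + 2)) ⟩
      ι m + + 2 - + 2      ≡⟨ there-and-back (ι m) ⟩
      ι m                  ∎)) (v-ι m)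
      where
      open ≡-mod-Reasoning
      there-and-back : ∀ x → x + + 2 - + 2 ≡ x
      there-and-back x = solve (x ∷ [])

    j+2k-1≡m : v n (j + + (2 ℕ.* k) - + 1) ≡ m
    j+2k-1≡m = trans (v-cong-mod (begin
      j + + (2 ℕ.* k) - + 1              ≈⟨ +-congʳ-mod (- + 1) (+-congʳ-mod (+ (2 ℕ.* k)) (ι-v (ι m + + 2))) ⟩
      ι m + + 2 + + (2 ℕ.* k) - + 1      ≡⟨ around (ι m) (+ (2 ℕ.* k)) ⟩
      ι m + + 1 * (+ 1 + + (2 ℕ.* k))    ≡⟨ cong (λ l → ι m + + 1 * + l) n≡1+2k ⟨
      ι m + + 1 * + n                    ≈⟨ +-multiple-mod (ι m) (+ 1) ⟩
      ι m                                ∎)) (v-ι m)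
      where
      open ≡-mod-Reasoning
      around : ∀ x y → x + + 2 + y - + 1 ≡ x + + 1 * (+ 1 + y)
      around x y = solve (x ∷ y ∷ [])

    present-not-removed : ∀ a → window G a ≡ true → ¬ RemovedWindow n k j a
    present-not-removed a present (inj₁ j-2≡a) =
      missing≢present {G} m a m-missing present (trans (sym j-2≡m) j-2≡a)
    present-not-removed a present (inj₂ j+2k-1≡a) =
      missing≢present {G} m a m-missing present (trans (sym j+2k-1≡m) j+2k-1≡a)

    not-removed-present : ∀ a → ¬ RemovedWindow n k j a → window G a ≡ true
    not-removed-present a ¬removed = ¬-not λ a-missing →
      ¬removed (inj₁ (trans j-2≡m
        (missing-window-unique {k} {G} n≡1+2k frameless connected m-missing a-missing)))

odd-or-even : ∀ n → 2 ∣ℕ n ⊎ Odd n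
odd-or-even n with n ℕ.% 2 in eq | m%n<n n 2
... | 0           | _ = inj₁ (m%n≡0⇒n∣m n 2 eq)
... | 1           | _ = inj₂ refl  -- the with has abstracted n % 2 inside Odd n
... | suc (suc _) | ℕ.s≤s (ℕ.s≤s ())

odd⇒≡1+2[n∸1]/2 : ∀ {n} → Odd n → n ≡ suc (2 ℕ.* ((n ℕ.∸ 1) ℕ./ 2))
odd⇒≡1+2[n∸1]/2 {n} odd = begin
  n                              ≡⟨ n≡1+[n/2]*2 ⟩
  suc (n ℕ./ 2 ℕ.* 2)            ≡⟨ cong suc (ℕ.*-comm (n ℕ./ 2) 2) ⟩
  suc (2 ℕ.* (n ℕ./ 2))          ≡⟨ cong (λ h → suc (2 ℕ.* h)) [n∸1]/2≡n/2 ⟨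
  suc (2 ℕ.* ((n ℕ.∸ 1) ℕ./ 2))  ∎
  where
  open ≡-Reasoning
  n≡1+[n/2]*2 : n ≡ suc (n ℕ./ 2 ℕ.* 2)
  n≡1+[n/2]*2 = trans (m≡m%n+[m/n]*n n 2) (cong (ℕ._+ n ℕ./ 2 ℕ.* 2) odd)
  [n∸1]/2≡n/2 : (n ℕ.∸ 1) ℕ./ 2 ≡ n ℕ./ 2
  [n∸1]/2≡n/2 = trans (cong (λ x → (x ℕ.∸ 1) ℕ./ 2) n≡1+[n/2]*2) (m*n/n≡m (n ℕ./ 2) 2)

lemma3p2 : (n : ℕ) .{{_ : NonZero n}} → 5 ≤ n → (G : Subgraph n) →
    Nontrivial G → WeaklyConnected G → Closed G →
    (∀ (i : Fin n) → frame G i ≡ false) →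
    Odd n × ∃ λ (j : Fin n) → IsS n ((n ℕ.∸ 1) ℕ./ 2) (+ toℕ j) G
lemma3p2 n _ G nontrivial connected _ frameless with odd-or-even n
... | inj₁ 2∣n = ⊥-elim (even-frameless-disconnected n {G} 2∣n frameless connected)
... | inj₂ odd =
  let m , m-missing = nontrivial⇒missing-window n {G} odd nontrivial frameless
  in odd , v n (ι m + + 2)
   , frameless-connected-IsS n {(n ℕ.∸ 1) ℕ./ 2} {G} (odd⇒≡1+2[n∸1]/2 odd) frameless connected m-missing
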